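{- Let $G$ be a hypo-unique domination graph of order at least $3$. Then: (i) for every $x\in V(G)$, the graph $G-x$ has no $\gamma$-critical vertices, i.e. $\gamma(G-x-u)\geq\gamma(G-x)$ for every $u\in V(G)\setminus\{x\}$; (ii) for every pair of distinct vertices $x,y$ of $G$, $\gamma(G-\{x,y\})\geq\gamma(G)-1$, and equality holds whenever $y$ does not belong to the unique $\gamma$-set of $G-x$.
   Context: All graphs are finite, simple and undirected. A dominating set of $G$ is a set $D\subseteq V(G)$ such that every vertex not in $D$ has a neighbor in $D$; $\gamma(G)$ is the minimum size of a dominating set, and a dominating set of size $\gamma(G)$ is a $\gamma$-set. A vertex $v$ of a graph $H$ is $\gamma$-critical if $\gamma(H-v)<\gamma(H)$. A graph $G$ is a hypo-unique domination graph if $G$ has at least two distinct $\gamma$-sets, but for every $v\in V(G)$ the graph $G-v$ has exactly one $\gamma$-set. -}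

module Defs where

open import Data.Nat using (ℕ; _≤_)
open import Data.Bool using (Bool; true; false)
open import Data.Fin using (Fin)
open import Data.Fin.Subset using (Subset; _∈_; _∉_; _⊆_; ∣_∣; ⊤; _-_)
open import Data.Product using (Σ; ∃; _×_; _,_)
open import Relation.Binary.PropositionalEquality using (_≡_; _≢_)

record Graph (n : ℕ) : Set where
  field
    adj   : Fin n → Fin n → Bool
    sym   : ∀ u v → adj u v ≡ adj v u
    irrefl : ∀ v → adj v v ≡ false

open Graph public

-- Induced subgraphs are represented by their vertex set W ⊆ V(G):
-- G - X is the subgraph of G induced by W = V(G) ∖ X.

Dominating : ∀ {n} → Graph n → Subset n → Subset n → Set
Dominating G W D =
  D ⊆ W × (∀ v → v ∈ W → v ∉ D → ∃ λ u → u ∈ D × adj G u v ≡ true)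

IsGammaSet : ∀ {n} → Graph n → Subset n → Subset n → Set
IsGammaSet G W D =
  Dominating G W D × (∀ D′ → Dominating G W D′ → ∣ D ∣ ≤ ∣ D′ ∣)

-- γ(G[W]) = k  (the domination number, as a relation; it always exists
-- and is unique for finite graphs).
IsDomNum : ∀ {n} → Graph n → Subset n → ℕ → Set
IsDomNum G W k = ∃ λ D → IsGammaSet G W D × ∣ D ∣ ≡ k

UniqueGammaSet : ∀ {n} → Graph n → Subset n → Set
UniqueGammaSet G W =
  ∃ λ D → IsGammaSet G W D × (∀ D′ → IsGammaSet G W D′ → D′ ≡ D)

HypoUnique : ∀ {n} → Graph n → Set
HypoUnique {n} G =
  (∃ λ D₁ → ∃ λ D₂ → IsGammaSet G ⊤ D₁ × IsGammaSet G ⊤ D₂ × D₁ ≢ D₂)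
  × (∀ (v : Fin n) → UniqueGammaSet G (⊤ - v))

-- Write S v for the unique γ-set of G - v.  The core fact is that every
-- vertex x of a hypo-unique graph is γ-critical.  Otherwise the γ-sets of G
-- avoiding x all equal S x, so x lies in some γ-set D and has an external
-- private neighbour w.  Whether w is critical or not, one finds that G has
-- exactly two γ-sets, and that they differ only by exchanging x and w; a third
-- vertex z then contradicts this, critical or not.  Given criticality, a
-- dominating set T of G - x - u with |T| < γ(G - x) extends by u and by every
-- neighbour y ≠ x of u to the unique γ-set of G - x, so x is the only neighbour
-- of u and T ∪ {x} dominates G with fewer than γ(G) vertices; this is (i), and
-- (ii) follows from (i) and γ(G) = γ(G - x) + 1.
module Submission where

open import Defs hiding (sym)
open import Data.Nat using (ℕ; suc; _≤_; _<_; _+_; z≤n; s≤s; s≤s⁻¹; _≤?_; _<?_)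
open import Data.Nat.Properties
  using (≤-trans; ≤-antisym; ≤-reflexive; m≤n⇒m≤1+n; +-suc; +-comm; ≮⇒≥; ≰⇒>; <⇒≱; <-≤-trans;
         module ≤-Reasoning)
open import Data.Bool using (true)
import Data.Bool.Properties as Bool
open import Data.Empty using (⊥; ⊥-elim)
open import Data.Fin using (Fin; zero; suc)
open import Data.Fin.Properties using (_≟_; any?; all?)
open import Data.Fin.Subset using (Subset; inside; outside; _∈_; _∉_; _⊆_; _∪_; _-_; ⁅_⁆; ∣_∣; ⊤)
open import Data.Fin.Subset.Properties
  using (_∈?_; ∈⊤; x∈⁅x⁆; x∈⁅y⁆⇒x≡y; ∣⁅x⁆∣≡1; ⊆-antisym; p⊆p∪q; q⊆p∪q; x∈p∪q⁻; p─q⊆p;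
         x∈p∧x≢y⇒x∈p-y; p─x─y≡p─y─x; x∈p⇒∣p-x∣<∣p∣)
open import Data.Vec using (_∷_; [])
open import Data.Vec.Base using (there)
open import Data.Vec.Properties using (≡-dec)
open import Data.Product using (_×_; _,_; proj₁; proj₂; ∃; map₁; map₂)
open import Data.Sum using (_⊎_; inj₁; inj₂; [_,_]; fromInj₁; fromInj₂)
import Data.Sum as Sum
open import Relation.Nullary using (¬_; Dec; yes; no; contradiction)
open import Relation.Nullary.Decidable using (_×-dec_; _→-dec_; ¬?)
open import Relation.Binary.PropositionalEquality
  using (_≡_; _≢_; refl; sym; trans; cong; subst; ≢-sym)

∣p∪q∣≤∣p∣+∣q∣ : ∀ {n} (p q : Subset n) → ∣ p ∪ q ∣ ≤ ∣ p ∣ + ∣ q ∣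
∣p∪q∣≤∣p∣+∣q∣ []            []            = z≤n
∣p∪q∣≤∣p∣+∣q∣ (outside ∷ p) (outside ∷ q) = ∣p∪q∣≤∣p∣+∣q∣ p q
∣p∪q∣≤∣p∣+∣q∣ (inside  ∷ p) (outside ∷ q) = s≤s (∣p∪q∣≤∣p∣+∣q∣ p q)
∣p∪q∣≤∣p∣+∣q∣ (outside ∷ p) (inside  ∷ q) =
  ≤-trans (s≤s (∣p∪q∣≤∣p∣+∣q∣ p q)) (≤-reflexive (sym (+-suc ∣ p ∣ ∣ q ∣)))
∣p∪q∣≤∣p∣+∣q∣ (inside  ∷ p) (inside  ∷ q) =
  s≤s (≤-trans (m≤n⇒m≤1+n (∣p∪q∣≤∣p∣+∣q∣ p q)) (≤-reflexive (sym (+-suc ∣ p ∣ ∣ q ∣))))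

∣p∪⁅x⁆∣≤1+∣p∣ : ∀ {n} (p : Subset n) x → ∣ p ∪ ⁅ x ⁆ ∣ ≤ suc ∣ p ∣
∣p∪⁅x⁆∣≤1+∣p∣ p x = begin
  ∣ p ∪ ⁅ x ⁆ ∣      ≤⟨ ∣p∪q∣≤∣p∣+∣q∣ p ⁅ x ⁆ ⟩
  ∣ p ∣ + ∣ ⁅ x ⁆ ∣  ≡⟨ cong (∣ p ∣ +_) (∣⁅x⁆∣≡1 x) ⟩
  ∣ p ∣ + 1          ≡⟨ +-comm ∣ p ∣ 1 ⟩
  suc ∣ p ∣          ∎
  where open ≤-Reasoning

∣p-y∪⁅x⁆∣≤∣p∣ : ∀ {n} {p : Subset n} {y} x → y ∈ p → ∣ (p - y) ∪ ⁅ x ⁆ ∣ ≤ ∣ p ∣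
∣p-y∪⁅x⁆∣≤∣p∣ {p = p} {y} x y∈p = ≤-trans (∣p∪⁅x⁆∣≤1+∣p∣ (p - y) x) (x∈p⇒∣p-x∣<∣p∣ y∈p)

x∉p-x : ∀ {n} {p : Subset n} x → x ∉ p - x
x∉p-x {p = inside  ∷ _} zero ()
x∉p-x {p = outside ∷ _} zero ()
x∉p-x {p = _ ∷ _} (suc x) (there x∈p-x) = x∉p-x x x∈p-x

x∈p-y⇒x≢y : ∀ {n} {p : Subset n} {x y} → x ∈ p - y → x ≢ y
x∈p-y⇒x≢y x∈p-y refl = x∉p-x _ x∈p-y

x∈p-y⇒x∈p : ∀ {n} {p : Subset n} {x y} → x ∈ p - y → x ∈ p
x∈p-y⇒x∈p {p = p} {y = y} = p─q⊆p p ⁅ y ⁆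

x∈p∪⁅x⁆ : ∀ {n} {p : Subset n} x → x ∈ p ∪ ⁅ x ⁆
x∈p∪⁅x⁆ {p = p} x = q⊆p∪q p ⁅ x ⁆ (x∈⁅x⁆ x)

x∈p∪⁅y⁆⁻ : ∀ {n} {p : Subset n} {x y} → x ∈ p ∪ ⁅ y ⁆ → x ∈ p ⊎ x ≡ y
x∈p∪⁅y⁆⁻ {p = p} {y = y} x∈ = Sum.map₂ (x∈⁅y⁆⇒x≡y y) (x∈p∪q⁻ p ⁅ y ⁆ x∈)

x∈p∪⁅y⁆∧x≢y⇒x∈p : ∀ {n} {p : Subset n} {x y} → x ∈ p ∪ ⁅ y ⁆ → x ≢ y → x ∈ p
x∈p∪⁅y⁆∧x≢y⇒x∈p x∈ x≢y = fromInj₁ (λ x≡y → contradiction x≡y x≢y) (x∈p∪⁅y⁆⁻ x∈)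

x∉p∪⁅y⁆ : ∀ {n} {p : Subset n} {x y} → x ∉ p → x ≢ y → x ∉ p ∪ ⁅ y ⁆
x∉p∪⁅y⁆ x∉p x≢y x∈ = x∉p (x∈p∪⁅y⁆∧x≢y⇒x∈p x∈ x≢y)

x∈p∪⁅y⁆⇒x∈p∪⁅z⁆ : ∀ {n} {p : Subset n} {x y} z → x ≢ y → x ∈ p ∪ ⁅ y ⁆ → x ∈ p ∪ ⁅ z ⁆
x∈p∪⁅y⁆⇒x∈p∪⁅z⁆ z x≢y x∈ = p⊆p∪q ⁅ z ⁆ (x∈p∪⁅y⁆∧x≢y⇒x∈p x∈ x≢y)

p-x⊆q⇒p⊆q : ∀ {n} {p q : Subset n} {x} → x ∈ q → p - x ⊆ q → p ⊆ q
p-x⊆q⇒p⊆q {x = x} x∈q p-x⊆q {t} t∈p with t ≟ x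
... | yes refl = x∈q
... | no  t≢x  = p-x⊆q (x∈p∧x≢y⇒x∈p-y t∈p t≢x)

p-x≡q⇒p≡q∪⁅x⁆ : ∀ {n} {p q : Subset n} {x} → x ∈ p → p - x ≡ q → p ≡ q ∪ ⁅ x ⁆
p-x≡q⇒p≡q∪⁅x⁆ {x = x} x∈p eq = ⊆-antisym
  (p-x⊆q⇒p⊆q (x∈p∪⁅x⁆ x) (λ t∈p-x → p⊆p∪q ⁅ x ⁆ (subst (_ ∈_) eq t∈p-x)))
  (λ t∈ → [ (λ t∈q → x∈p-y⇒x∈p (subst (_ ∈_) (sym eq) t∈q)) , (λ { refl → x∈p }) ] (x∈p∪⁅y⁆⁻ t∈))

p-x≡q-x⇒p≡q : ∀ {n} {p q : Subset n} {x} → x ∈ p → x ∈ q → p - x ≡ q - x → p ≡ q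
p-x≡q-x⇒p≡q x∈p x∈q eq = trans (p-x≡q⇒p≡q∪⁅x⁆ x∈p eq) (sym (p-x≡q⇒p≡q∪⁅x⁆ x∈q refl))

p∪⁅y⁆≡q∪⁅y⁆⇒p≡q : ∀ {n} {p q : Subset n} {y} → y ∉ p → y ∉ q → p ∪ ⁅ y ⁆ ≡ q ∪ ⁅ y ⁆ → p ≡ q
p∪⁅y⁆≡q∪⁅y⁆⇒p≡q {y = y} y∉p y∉q eq = ⊆-antisym (⊆-cancel y∉p eq) (⊆-cancel y∉q (sym eq))
  where
  ⊆-cancel : ∀ {p q} → y ∉ p → p ∪ ⁅ y ⁆ ≡ q ∪ ⁅ y ⁆ → p ⊆ q
  ⊆-cancel y∉p eq t∈p = x∈p∪⁅y⁆∧x≢y⇒x∈p (subst (_ ∈_) eq (p⊆p∪q ⁅ y ⁆ t∈p)) λ { refl → y∉p t∈p }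

third-vertex : ∀ {n} → 3 ≤ n → (x y : Fin n) → ∃ λ z → z ≢ x × z ≢ y
third-vertex (s≤s (s≤s (s≤s _))) zero          zero          = suc zero       , (λ ()) , (λ ())
third-vertex (s≤s (s≤s (s≤s _))) zero          (suc zero)    = suc (suc zero) , (λ ()) , (λ ())
third-vertex (s≤s (s≤s (s≤s _))) zero          (suc (suc _)) = suc zero       , (λ ()) , (λ ())
third-vertex (s≤s (s≤s (s≤s _))) (suc zero)    zero          = suc (suc zero) , (λ ()) , (λ ())
third-vertex (s≤s (s≤s (s≤s _))) (suc zero)    (suc _)       = zero           , (λ ()) , (λ ())
third-vertex (s≤s (s≤s (s≤s _))) (suc (suc _)) zero          = suc zero       , (λ ()) , (λ ())
third-vertex (s≤s (s≤s (s≤s _))) (suc (suc _)) (suc _)       = zero           , (λ ()) , (λ ())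

module Domination {n : ℕ} (G : Graph n) where

  infix 4 _~_ _~?_

  _~_ : Fin n → Fin n → Set
  u ~ v = adj G u v ≡ true

  _~?_ : ∀ u v → Dec (u ~ v)
  u ~? v = adj G u v Bool.≟ true

  ~-sym : ∀ {u v} → u ~ v → v ~ u
  ~-sym {u} {v} = trans (Graph.sym G v u)

  ~⇒≢ : ∀ {u v} → u ~ v → u ≢ v
  ~⇒≢ {u} u~u refl with trans (sym u~u) (irrefl G u)
  ... | ()

  HasNeighbourIn : Subset n → Fin n → Set
  HasNeighbourIn D v = ∃ λ u → u ∈ D × u ~ v

  ExternalPrivateNeighbour : Subset n → Fin n → Fin n → Set
  ExternalPrivateNeighbour D v w = w ∉ D × v ~ w × (∀ u → u ∈ D → u ~ w → u ≡ v)

  epn? : ∀ D v w → Dec (ExternalPrivateNeighbour D v w)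
  epn? D v w = ¬? (w ∈? D) ×-dec v ~? w ×-dec all? (λ u → u ∈? D →-dec u ~? w →-dec u ≟ v)

  epn⊎dominated-by-D-v : ∀ {W D v w} → Dominating G W D → w ∈ W → w ∉ D →
                         ExternalPrivateNeighbour D v w ⊎ HasNeighbourIn (D - v) w
  epn⊎dominated-by-D-v {D = D} {v} {w} (_ , dom) w∈W w∉D
    with any? (λ u → u ∈? D - v ×-dec u ~? w)
  ... | yes shared = inj₂ shared
  ... | no ¬shared with dom w w∈W w∉D
  ...   | u , u∈D , u~w = inj₁ (w∉D , subst (_~ w) (only u u∈D u~w) u~w , only)
    where
    only : ∀ t → t ∈ D → t ~ w → t ≡ v
    only t t∈D t~w with t ≟ v
    ... | yes t≡v = t≡v
    ... | no  t≢v = contradiction (t , x∈p∧x≢y⇒x∈p-y t∈D t≢v , t~w) ¬shared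

  dominating-delete-∉ : ∀ {W D v} → Dominating G W D → v ∉ D → Dominating G (W - v) D
  dominating-delete-∉ (D⊆W , dom) v∉D =
    (λ u∈D → x∈p∧x≢y⇒x∈p-y (D⊆W u∈D) λ { refl → v∉D u∈D }) ,
    (λ u u∈W-v → dom u (x∈p-y⇒x∈p u∈W-v))

  dominating-restore : ∀ {W R v} → Dominating G (W - v) R → HasNeighbourIn R v → Dominating G W R
  dominating-restore {W} {R} {v} (R⊆W-v , dom) v-dominated = (λ u∈R → x∈p-y⇒x∈p (R⊆W-v u∈R)) , cover
    where
    cover : ∀ u → u ∈ W → u ∉ R → HasNeighbourIn R u
    cover u u∈W u∉R with u ≟ v
    ... | yes refl = v-dominated
    ... | no  u≢v  = dom u (x∈p∧x≢y⇒x∈p-y u∈W u≢v) u∉R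

  dominating-insert : ∀ {W R v y} → Dominating G (W - v) R → y ∈ W → y ≡ v ⊎ y ~ v →
                      Dominating G W (R ∪ ⁅ y ⁆)
  dominating-insert {W} {R} {v} {y} (R⊆W-v , dom) y∈W y∈N[v] = sub , cover y∈N[v]
    where
    sub : R ∪ ⁅ y ⁆ ⊆ W
    sub u∈ = [ (λ u∈R → x∈p-y⇒x∈p (R⊆W-v u∈R)) , (λ { refl → y∈W }) ] (x∈p∪⁅y⁆⁻ u∈)
    cover : y ≡ v ⊎ y ~ v → ∀ u → u ∈ W → u ∉ R ∪ ⁅ y ⁆ → HasNeighbourIn (R ∪ ⁅ y ⁆) u
    cover y∈N[v] u u∈W u∉ with u ≟ v | y∈N[v]
    ... | yes refl | inj₁ refl = contradiction (x∈p∪⁅x⁆ u) u∉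
    ... | yes refl | inj₂ y~u  = y , x∈p∪⁅x⁆ y , y~u
    ... | no  u≢v  | _         =
      map₂ (map₁ (p⊆p∪q ⁅ y ⁆))
           (dom u (x∈p∧x≢y⇒x∈p-y u∈W u≢v) (λ u∈R → u∉ (p⊆p∪q ⁅ y ⁆ u∈R)))

  dominating-delete-epn-free : ∀ {W D v} → Dominating G W D →
                               (∀ w → w ∈ W → ¬ ExternalPrivateNeighbour D v w) →
                               Dominating G (W - v) (D - v)
  dominating-delete-epn-free {W} {D} {v} d@(D⊆W , _) no-epn = sub , cover
    where
    sub : D - v ⊆ W - v
    sub u∈D-v = x∈p∧x≢y⇒x∈p-y (D⊆W (x∈p-y⇒x∈p u∈D-v)) (x∈p-y⇒x≢y u∈D-v)
    cover : ∀ u → u ∈ W - v → u ∉ D - v → HasNeighbourIn (D - v) u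
    cover u u∈W-v u∉D-v =
      fromInj₂ (λ epn → contradiction epn (no-epn u (x∈p-y⇒x∈p u∈W-v)))
               (epn⊎dominated-by-D-v d (x∈p-y⇒x∈p u∈W-v)
                  (λ u∈D → u∉D-v (x∈p∧x≢y⇒x∈p-y u∈D (x∈p-y⇒x≢y u∈W-v))))

  dominating-swap : ∀ {W D x w} → Dominating G W D → x ∈ W → x ~ w →
                    (∀ v → v ∈ W → ExternalPrivateNeighbour D w v → v ≡ x) →
                    Dominating G W ((D - w) ∪ ⁅ x ⁆)
  dominating-swap {W} {D} {x} {w} d@(D⊆W , _) x∈W x~w epn≡x = sub , cover
    where
    sub : (D - w) ∪ ⁅ x ⁆ ⊆ W
    sub u∈ = [ (λ u∈D-w → D⊆W (x∈p-y⇒x∈p u∈D-w)) , (λ { refl → x∈W }) ] (x∈p∪⁅y⁆⁻ u∈)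
    cover : ∀ v → v ∈ W → v ∉ (D - w) ∪ ⁅ x ⁆ → HasNeighbourIn ((D - w) ∪ ⁅ x ⁆) v
    cover v v∈W v∉ with v ≟ w
    ... | yes refl = x , x∈p∪⁅x⁆ x , x~w
    ... | no  v≢w  with epn⊎dominated-by-D-v d v∈W (λ v∈D → v∉ (p⊆p∪q ⁅ x ⁆ (x∈p∧x≢y⇒x∈p-y v∈D v≢w)))
    ...   | inj₂ (t , t∈D-w , t~v) = t , p⊆p∪q ⁅ x ⁆ t∈D-w , t~v
    ...   | inj₁ epn with epn≡x v v∈W epn
    ...     | refl = contradiction (x∈p∪⁅x⁆ v) v∉

  γ-sets-same-size : ∀ {W D D′} → IsGammaSet G W D → IsGammaSet G W D′ → ∣ D ∣ ≡ ∣ D′ ∣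
  γ-sets-same-size (d , min) (d′ , min′) = ≤-antisym (min _ d′) (min′ _ d)

  dominating⇒γ-set : ∀ {W D D′} → IsGammaSet G W D → Dominating G W D′ → ∣ D′ ∣ ≤ ∣ D ∣ →
                     IsGammaSet G W D′
  dominating⇒γ-set (_ , min) d′ ∣D′∣≤∣D∣ = d′ , λ E dE → ≤-trans ∣D′∣≤∣D∣ (min E dE)

  γ-set-swap : ∀ {W D x w} → IsGammaSet G W D → w ∈ D → x ∈ W → x ~ w →
               (∀ v → v ∈ W → ExternalPrivateNeighbour D w v → v ≡ x) →
               IsGammaSet G W ((D - w) ∪ ⁅ x ⁆)
  γ-set-swap γD w∈D x∈W x~w epn≡x =
    dominating⇒γ-set γD (dominating-swap (proj₁ γD) x∈W x~w epn≡x) (∣p-y∪⁅x⁆∣≤∣p∣ _ w∈D)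

  Leaf : Fin n → Fin n → Set
  Leaf v x = x ~ v × (∀ u → u ~ v → u ≡ x)

  leaf∈dominating : ∀ {W D v x} → Dominating G W D → v ∈ W → Leaf v x → x ∉ D → v ∈ D
  leaf∈dominating {D = D} {v} (_ , dom) v∈W (_ , only) x∉D with v ∈? D
  ... | yes v∈D = v∈D
  ... | no  v∉D with dom v v∈W v∉D
  ...   | u , u∈D , u~v = contradiction (subst (_∈ D) (only u u~v) u∈D) x∉D

  leaf∉γ-set : ∀ {W D v x} → IsGammaSet G W D → Leaf v x → x ∈ D → v ∉ D
  leaf∉γ-set {W} {D} {v} {x} (d , min) (x~v , only) x∈D v∈D =
    <⇒≱ (x∈p⇒∣p-x∣<∣p∣ v∈D) (min (D - v) smaller)
    where
    no-epn : ∀ w → w ∈ W → ¬ ExternalPrivateNeighbour D v w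
    no-epn w _ (w∉D , v~w , _) = w∉D (subst (_∈ D) (sym (only w (~-sym v~w))) x∈D)
    smaller : Dominating G W (D - v)
    smaller = dominating-restore (dominating-delete-epn-free d no-epn)
                                 (x , x∈p∧x≢y⇒x∈p-y x∈D (~⇒≢ x~v) , x~v)

module VertexDeletion {n : ℕ} (G : Graph n) (unique : ∀ v → UniqueGammaSet G (⊤ - v))
                      {D₁ : Subset n} (γ₁ : IsGammaSet G ⊤ D₁) where

  open Domination G

  γ-set : Subset n → Set
  γ-set = IsGammaSet G ⊤

  AllGammaSetsAmong : Subset n → Subset n → Set
  AllGammaSetsAmong D D′ = ∀ T → γ-set T → T ≡ D ⊎ T ≡ D′

  g : ℕ
  g = ∣ D₁ ∣

  S : Fin n → Subset n
  S v = proj₁ (unique v)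

  S-γ-set : ∀ v → IsGammaSet G (⊤ - v) (S v)
  S-γ-set v = proj₁ (proj₂ (unique v))

  S-unique : ∀ v {D} → IsGammaSet G (⊤ - v) D → D ≡ S v
  S-unique v = proj₂ (proj₂ (unique v)) _

  s : Fin n → ℕ
  s v = ∣ S v ∣

  Critical : Fin n → Set
  Critical v = s v < g

  critical? : ∀ v → Dec (Critical v)
  critical? v = s v <? g

  γ-set-size : ∀ {D} → γ-set D → ∣ D ∣ ≡ g
  γ-set-size γD = γ-sets-same-size γD γ₁

  g-minimal : ∀ {D} → Dominating G ⊤ D → g ≤ ∣ D ∣
  g-minimal = proj₂ γ₁ _

  γ-set-intro : ∀ {D} → Dominating G ⊤ D → ∣ D ∣ ≤ g → γ-set D
  γ-set-intro = dominating⇒γ-set γ₁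

  γ-set-delete-size : ∀ {D v} → γ-set D → v ∈ D → ∣ D - v ∣ < g
  γ-set-delete-size {D} {v} γD v∈D = subst (∣ D - v ∣ <_) (γ-set-size γD) (x∈p⇒∣p-x∣<∣p∣ v∈D)

  s-minimal : ∀ v {R} → Dominating G (⊤ - v) R → s v ≤ ∣ R ∣
  s-minimal v = proj₂ (S-γ-set v) _

  S-intro : ∀ v {R} → Dominating G (⊤ - v) R → ∣ R ∣ ≤ s v → R ≡ S v
  S-intro v dR ∣R∣≤s = S-unique v (dominating⇒γ-set (S-γ-set v) dR ∣R∣≤s)

  v∉S : ∀ v → v ∉ S v
  v∉S v v∈S = x∈p-y⇒x≢y (proj₁ (proj₁ (S-γ-set v)) v∈S) refl

  g≤1+s : ∀ v → g ≤ suc (s v)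
  g≤1+s v = ≤-trans (g-minimal (dominating-insert (proj₁ (S-γ-set v)) ∈⊤ (inj₁ refl)))
                    (∣p∪⁅x⁆∣≤1+∣p∣ (S v) v)

  γ-set-avoiding≡S : ∀ {v D} → ¬ Critical v → γ-set D → v ∉ D → D ≡ S v
  γ-set-avoiding≡S {v} v-nc γD v∉D =
    S-intro v (dominating-delete-∉ (proj₁ γD) v∉D) (≤-trans (≤-reflexive (γ-set-size γD)) (≮⇒≥ v-nc))

  γ-sets-avoiding-equal : ∀ {v D D′} → ¬ Critical v → γ-set D → γ-set D′ → v ∉ D → v ∉ D′ → D ≡ D′
  γ-sets-avoiding-equal v-nc γD γD′ v∉D v∉D′ =
    trans (γ-set-avoiding≡S v-nc γD v∉D) (sym (γ-set-avoiding≡S v-nc γD′ v∉D′))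

  noncritical⇒epn : ∀ {v D} → ¬ Critical v → γ-set D → v ∈ D → ∃ (ExternalPrivateNeighbour D v)
  noncritical⇒epn {v} {D} v-nc γD v∈D with any? (epn? D v)
  ... | yes epn = epn
  ... | no ¬epn = contradiction (≤-trans (≮⇒≥ v-nc) (s-minimal v smaller))
                                (<⇒≱ (γ-set-delete-size γD v∈D))
    where
    smaller : Dominating G (⊤ - v) (D - v)
    smaller = dominating-delete-epn-free (proj₁ γD) (λ w _ epn → ¬epn (w , epn))

  S∪closed-neighbour : ∀ {v y} → Critical v → y ≡ v ⊎ y ~ v → γ-set (S v ∪ ⁅ y ⁆)
  S∪closed-neighbour {v} {y} v-c y∈N[v] =
    γ-set-intro (dominating-insert (proj₁ (S-γ-set v)) ∈⊤ y∈N[v]) (≤-trans (∣p∪⁅x⁆∣≤1+∣p∣ (S v) y) v-c)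

  neighbour∉S : ∀ {v u} → Critical v → u ~ v → u ∉ S v
  neighbour∉S {v} {u} v-c u~v u∈S =
    <⇒≱ v-c (g-minimal (dominating-restore (proj₁ (S-γ-set v)) (u , u∈S , u~v)))

  noncritical~critical⇒leaf : ∀ {x y} → ¬ Critical x → Critical y → x ~ y → Leaf y x
  noncritical~critical⇒leaf {x} {y} x-nc y-c x~y = x~y , only-x
    where
    only-x : ∀ z → z ~ y → z ≡ x
    only-x z z~y with z ≟ x
    ... | yes z≡x = z≡x
    ... | no  z≢x = ⊥-elim (v∉S y (x∈p∪⁅y⁆∧x≢y⇒x∈p (subst (y ∈_) same (x∈p∪⁅x⁆ y)) (≢-sym (~⇒≢ z~y))))
      where
      x∉S : x ∉ S y
      x∉S = neighbour∉S y-c x~y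
      same : S y ∪ ⁅ y ⁆ ≡ S y ∪ ⁅ z ⁆
      same = γ-sets-avoiding-equal x-nc
               (S∪closed-neighbour y-c (inj₁ refl)) (S∪closed-neighbour y-c (inj₂ z~y))
               (x∉p∪⁅y⁆ x∉S (~⇒≢ x~y)) (x∉p∪⁅y⁆ x∉S (≢-sym z≢x))

  module HypoUniqueness {D₂ : Subset n} (γ₂ : γ-set D₂) (D₁≢D₂ : D₁ ≢ D₂) (3≤n : 3 ≤ n) where

    another-γ-set : ∀ D → ∃ λ D′ → γ-set D′ × D′ ≢ D
    another-γ-set D with ≡-dec Bool._≟_ D₁ D
    ... | yes refl = D₂ , γ₂ , ≢-sym D₁≢D₂
    ... | no  D₁≢D = D₁ , γ₁ , D₁≢D

    has-neighbour : ∀ u → ∃ λ t → t ~ u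
    has-neighbour u with any? (_~? u)
    ... | yes neighbour = neighbour
    ... | no  isolated  =
      contradiction (p-x≡q-x⇒p≡q (u∈γ-set γ₁) (u∈γ-set γ₂) (trans (γ-set-u≡S γ₁) (sym (γ-set-u≡S γ₂))))
                    D₁≢D₂
      where
      u∈γ-set : ∀ {D} → γ-set D → u ∈ D
      u∈γ-set {D} γD with u ∈? D
      ... | yes u∈D = u∈D
      ... | no  u∉D = contradiction (map₂ proj₂ (proj₂ (proj₁ γD) u ∈⊤ u∉D)) isolated
      γ-set-u≡S : ∀ {D} → γ-set D → D - u ≡ S u
      γ-set-u≡S γD =
        S-intro u (dominating-delete-epn-free (proj₁ γD) λ { w _ (_ , u~w , _) → isolated (w , ~-sym u~w) })
                  (s≤s⁻¹ (<-≤-trans (γ-set-delete-size γD (u∈γ-set γD)) (g≤1+s u)))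

    -- G cannot have exactly two γ-sets D ∋ x and D′ ∋ w related by exchanging the adjacent x and w.
    module _ {D D′ : Subset n} {x w : Fin n} (γD : γ-set D) (γD′ : γ-set D′) (among : AllGammaSetsAmong D D′)
             (x∈D : x ∈ D) (x∉D′ : x ∉ D′) (w∈D′ : w ∈ D′) (w∉D : w ∉ D) (x~w : x ~ w)
             (D′-w⊆D : D′ - w ⊆ D) where

      ∉D⇒∈D′ : ∀ {u} → u ∉ D → u ∈ D′
      ∉D⇒∈D′ {u} u∉D with u ∈? D′ | critical? u
      ... | yes u∈D′ | _      = u∈D′
      ... | no  u∉D′ | no u-nc =
        contradiction (γ-sets-avoiding-equal u-nc γD γD′ u∉D u∉D′) λ D≡D′ → x∉D′ (subst (x ∈_) D≡D′ x∈D)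
      ... | no  u∉D′ | yes u-c =
        ⊥-elim ([ missing u∉D , missing u∉D′ ] (among _ (S∪closed-neighbour u-c (inj₁ refl))))
        where
        missing : ∀ {A} → u ∉ A → S u ∪ ⁅ u ⁆ ≢ A
        missing u∉A e = u∉A (subst (u ∈_) e (x∈p∪⁅x⁆ u))

      ≢w⇒∈D : ∀ {u} → u ≢ w → u ∈ D
      ≢w⇒∈D {u} u≢w with u ∈? D
      ... | yes u∈D = u∈D
      ... | no  u∉D = D′-w⊆D (x∈p∧x≢y⇒x∈p-y (∉D⇒∈D′ u∉D) u≢w)

      critical-third-vertex-impossible : ∀ {z} → Critical z → z ≢ x → z ≢ w → ⊥
      critical-third-vertex-impossible {z} z-c z≢x z≢w with has-neighbour z
      ... | y , y~z =
        cases (among _ (S∪closed-neighbour z-c (inj₁ refl))) (among _ (S∪closed-neighbour z-c (inj₂ y~z)))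
        where
        Dᶻ≢Dʸ : S z ∪ ⁅ z ⁆ ≢ S z ∪ ⁅ y ⁆
        Dᶻ≢Dʸ e = x∉p∪⁅y⁆ (v∉S z) (≢-sym (~⇒≢ y~z)) (subst (z ∈_) e (x∈p∪⁅x⁆ z))
        transfer : ∀ {t A B} → t ≢ z → S z ∪ ⁅ z ⁆ ≡ A → S z ∪ ⁅ y ⁆ ≡ B → t ∈ A → t ∈ B
        transfer t≢z refl refl = x∈p∪⁅y⁆⇒x∈p∪⁅z⁆ y t≢z
        cases : S z ∪ ⁅ z ⁆ ≡ D ⊎ S z ∪ ⁅ z ⁆ ≡ D′ → S z ∪ ⁅ y ⁆ ≡ D ⊎ S z ∪ ⁅ y ⁆ ≡ D′ → ⊥
        cases (inj₁ e) (inj₁ e′) = Dᶻ≢Dʸ (trans e (sym e′))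
        cases (inj₂ e) (inj₂ e′) = Dᶻ≢Dʸ (trans e (sym e′))
        cases (inj₁ e) (inj₂ e′) = x∉D′ (transfer (≢-sym z≢x) e e′ x∈D)
        cases (inj₂ e) (inj₁ e′) = w∉D (transfer (≢-sym z≢w) e e′ w∈D′)

      noncritical-third-vertex-impossible : ∀ {z} → ¬ Critical z → z ≢ x → z ≢ w → ⊥
      noncritical-third-vertex-impossible z-nc z≢x z≢w with noncritical⇒epn z-nc γD (≢w⇒∈D z≢w)
      ... | u , u∉D , _ , only-z with u ≟ w
      ...   | yes refl = z≢x (sym (only-z x x∈D x~w))
      ...   | no  u≢w  = u∉D (≢w⇒∈D u≢w)

      no-swap-pair : ⊥
      no-swap-pair with third-vertex 3≤n x w
      ... | z , z≢x , z≢w with critical? z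
      ...   | yes z-c  = critical-third-vertex-impossible z-c z≢x z≢w
      ...   | no  z-nc = noncritical-third-vertex-impossible z-nc z≢x z≢w

    module _ {x w D} (x-nc : ¬ Critical x) (γD : γ-set D) (x∈D : x ∈ D)
             (w∉D : w ∉ D) (x~w : x ~ w) (x-only : ∀ u → u ∈ D → u ~ w → u ≡ x) (w-nc : ¬ Critical w) where

      w∈other : ∀ {D′} → γ-set D′ → D′ ≢ D → w ∈ D′
      w∈other {D′} γD′ D′≢D with w ∈? D′
      ... | yes w∈D′ = w∈D′
      ... | no  w∉D′ = contradiction (γ-sets-avoiding-equal w-nc γD′ γD w∉D′ w∉D) D′≢D

      epn-of-w≡x : ∀ {D′ u} → γ-set D′ → D′ ≢ D → ExternalPrivateNeighbour D′ w u → u ≡ x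
      epn-of-w≡x {D′} {u} γD′ D′≢D (u∉D′ , w~u , _) with u ∈? D | critical? u
      ... | yes u∈D | _       = x-only u u∈D (~-sym w~u)
      ... | no  u∉D | no u-nc = contradiction (γ-sets-avoiding-equal u-nc γD′ γD u∉D′ u∉D) D′≢D
      ... | no  u∉D | yes u-c =
        contradiction (leaf∈dominating (proj₁ γD) ∈⊤ (noncritical~critical⇒leaf w-nc u-c w~u) w∉D) u∉D

      x∉other : ∀ {D′} → γ-set D′ → D′ ≢ D → x ∉ D′
      x∉other γD′ D′≢D with noncritical⇒epn w-nc γD′ (w∈other γD′ D′≢D)
      ... | u , epn = subst (_∉ _) (epn-of-w≡x γD′ D′≢D epn) (proj₁ epn)

      γ-sets-D-or-S : AllGammaSetsAmong D (S x)
      γ-sets-D-or-S T γT with ≡-dec Bool._≟_ T D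
      ... | yes T≡D = inj₁ T≡D
      ... | no  T≢D = inj₂ (γ-set-avoiding≡S x-nc γT (x∉other γT T≢D))

      S-γ-set-of-G : γ-set (S x)
      S-γ-set-of-G with another-γ-set D
      ... | D′ , γD′ , D′≢D = subst γ-set (γ-set-avoiding≡S x-nc γD′ (x∉other γD′ D′≢D)) γD′

      S≢D : S x ≢ D
      S≢D S≡D = v∉S x (subst (x ∈_) (sym S≡D) x∈D)

      swap≡D : (S x - w) ∪ ⁅ x ⁆ ≡ D
      swap≡D = fromInj₁ (λ e → contradiction (subst (x ∈_) e (x∈p∪⁅x⁆ x)) (v∉S x))
                        (γ-sets-D-or-S _ (γ-set-swap S-γ-set-of-G (w∈other S-γ-set-of-G S≢D) ∈⊤ x~w
                                                     (λ v _ → epn-of-w≡x S-γ-set-of-G S≢D)))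

      noncritical-epn-impossible : ⊥
      noncritical-epn-impossible =
        no-swap-pair γD S-γ-set-of-G γ-sets-D-or-S x∈D (v∉S x) (w∈other S-γ-set-of-G S≢D) w∉D x~w
                     (λ t∈ → subst (_ ∈_) swap≡D (p⊆p∪q ⁅ x ⁆ t∈))

    module _ {x w} (x-nc : ¬ Critical x) (w-c : Critical w) (x~w : x ~ w) where

      Dˣ Dʷ : Subset n
      Dˣ = S w ∪ ⁅ x ⁆
      Dʷ = S w ∪ ⁅ w ⁆

      γˣ : γ-set Dˣ
      γˣ = S∪closed-neighbour w-c (inj₂ x~w)

      γʷ : γ-set Dʷ
      γʷ = S∪closed-neighbour w-c (inj₁ refl)

      x∉Dʷ : x ∉ Dʷ
      x∉Dʷ = x∉p∪⁅y⁆ (neighbour∉S w-c x~w) (~⇒≢ x~w)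

      epn-of-x≡w : ∀ {T v} → γ-set T → x ∈ T → ExternalPrivateNeighbour T x v → v ≡ w
      epn-of-x≡w {T} {v} γT x∈T (v∉T , x~v , x-only) with v ≟ w | critical? v
      ... | yes v≡w | _       = v≡w
      ... | no  _   | no v-nc = ⊥-elim (noncritical-epn-impossible x-nc γT x∈T v∉T x~v x-only v-nc)
      ... | no  v≢w | yes v-c = ⊥-elim (leaf∉γ-set γˣ v-leaf (x∈p∪⁅x⁆ x) v∈Dˣ)
        where
        v-leaf : Leaf v x
        v-leaf = noncritical~critical⇒leaf x-nc v-c x~v
        v∈Dˣ : v ∈ Dˣ
        v∈Dˣ = p⊆p∪q ⁅ x ⁆ (x∈p∪⁅y⁆∧x≢y⇒x∈p (leaf∈dominating (proj₁ γʷ) ∈⊤ v-leaf x∉Dʷ) v≢w)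

      γ-set∋x≡Dˣ : ∀ {T} → γ-set T → x ∈ T → T ≡ Dˣ
      γ-set∋x≡Dˣ {T} γT x∈T =
        p-x≡q⇒p≡q∪⁅x⁆ x∈T (p∪⁅y⁆≡q∪⁅y⁆⇒p≡q (λ w∈T-x → w∉T (x∈p-y⇒x∈p w∈T-x)) (v∉S w)
                                            (γ-sets-avoiding-equal x-nc γT′ γʷ x∉T′ x∉Dʷ))
        where
        w∉T : w ∉ T
        w∉T = leaf∉γ-set γT (noncritical~critical⇒leaf x-nc w-c x~w) x∈T
        γT′ : γ-set ((T - x) ∪ ⁅ w ⁆)
        γT′ = γ-set-swap γT x∈T ∈⊤ (~-sym x~w) (λ v _ → epn-of-x≡w γT x∈T)
        x∉T′ : x ∉ (T - x) ∪ ⁅ w ⁆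
        x∉T′ = x∉p∪⁅y⁆ (x∉p-x x) (~⇒≢ x~w)

      γ-sets-Dˣ-or-Dʷ : AllGammaSetsAmong Dˣ Dʷ
      γ-sets-Dˣ-or-Dʷ T γT with x ∈? T
      ... | yes x∈T = inj₁ (γ-set∋x≡Dˣ γT x∈T)
      ... | no  x∉T = inj₂ (γ-sets-avoiding-equal x-nc γT γʷ x∉T x∉Dʷ)

      noncritical~critical-impossible : ⊥
      noncritical~critical-impossible =
        no-swap-pair γˣ γʷ γ-sets-Dˣ-or-Dʷ (x∈p∪⁅x⁆ x) x∉Dʷ (x∈p∪⁅x⁆ w) (x∉p∪⁅y⁆ (v∉S w) (≢-sym (~⇒≢ x~w)))
                     x~w (λ t∈ → p⊆p∪q ⁅ x ⁆ (x∈p∪⁅y⁆∧x≢y⇒x∈p (x∈p-y⇒x∈p t∈) (x∈p-y⇒x≢y t∈)))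

    noncritical∈γ-set : ∀ {x} → ¬ Critical x → ∃ λ D → γ-set D × x ∈ D
    noncritical∈γ-set {x} x-nc with x ∈? D₁ | x ∈? D₂
    ... | yes x∈D₁ | _        = D₁ , γ₁ , x∈D₁
    ... | no  _    | yes x∈D₂ = D₂ , γ₂ , x∈D₂
    ... | no  x∉D₁ | no  x∉D₂ = contradiction (γ-sets-avoiding-equal x-nc γ₁ γ₂ x∉D₁ x∉D₂) D₁≢D₂

    every-vertex-critical : ∀ x → Critical x
    every-vertex-critical x with critical? x
    ... | yes x-c  = x-c
    ... | no  x-nc with noncritical∈γ-set x-nc
    ...   | D , γD , x∈D with noncritical⇒epn x-nc γD x∈D
    ...     | w , w∉D , x~w , x-only with critical? w
    ...       | yes w-c  = ⊥-elim (noncritical~critical-impossible x-nc w-c x~w)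
    ...       | no  w-nc = ⊥-elim (noncritical-epn-impossible x-nc γD x∈D w∉D x~w x-only w-nc)

    s-minimal-after-deletion : ∀ {x u T} → u ≢ x → Dominating G ((⊤ - x) - u) T → s x ≤ ∣ T ∣
    s-minimal-after-deletion {x} {u} {T} u≢x dT with s x ≤? ∣ T ∣
    ... | yes s≤∣T∣ = s≤∣T∣
    ... | no  s≰∣T∣ =
      ⊥-elim (<⇒≱ (every-vertex-critical x)
                  (≤-trans (g-minimal dominating) (≤-trans (∣p∪⁅x⁆∣≤1+∣p∣ T x) small)))
      where
      small : ∣ T ∣ < s x
      small = ≰⇒> s≰∣T∣
      T∪⁅y⁆≡S : ∀ {y} → y ≢ x → y ≡ u ⊎ y ~ u → T ∪ ⁅ y ⁆ ≡ S x
      T∪⁅y⁆≡S {y} y≢x y∈N[u] =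
        S-intro x (dominating-insert dT (x∈p∧x≢y⇒x∈p-y ∈⊤ y≢x) y∈N[u]) (≤-trans (∣p∪⁅x⁆∣≤1+∣p∣ T y) small)
      u∉T : u ∉ T
      u∉T u∈T = x∈p-y⇒x≢y (proj₁ dT u∈T) refl
      x-only : ∀ y → y ~ u → y ≡ x
      x-only y y~u with y ≟ x
      ... | yes y≡x = y≡x
      ... | no  y≢x = ⊥-elim (x∉p∪⁅y⁆ u∉T (≢-sym (~⇒≢ y~u))
                               (subst (u ∈_) (trans (T∪⁅y⁆≡S u≢x (inj₁ refl)) (sym (T∪⁅y⁆≡S y≢x (inj₂ y~u))))
                                      (x∈p∪⁅x⁆ u)))
      x~u : x ~ u
      x~u with has-neighbour u
      ... | y , y~u = subst (_~ u) (x-only y y~u) y~u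
      dominating : Dominating G ⊤ (T ∪ ⁅ x ⁆)
      dominating = dominating-restore
        (dominating-insert (subst (λ W → Dominating G W T) (p─x─y≡p─y─x ⊤ x u) dT)
                           (x∈p∧x≢y⇒x∈p-y ∈⊤ (≢-sym u≢x)) (inj₁ refl))
        (x , x∈p∪⁅x⁆ x , x~u)

    γ[G-x]≤γ[G-x-u] : ∀ (x u : Fin n) → u ≢ x → ∀ k m →
                                 IsDomNum G (⊤ - x) k → IsDomNum G ((⊤ - x) - u) m → k ≤ m
    γ[G-x]≤γ[G-x-u] x u u≢x _ _ (D , γD , refl) (T , γT , refl) =
      subst (_≤ ∣ T ∣) (cong ∣_∣ (sym (S-unique x γD))) (s-minimal-after-deletion u≢x (proj₁ γT))

    γ[G]≤γ[G-x-y]+1 : ∀ (x y : Fin n) → x ≢ y → ∀ g′ k →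
                 IsDomNum G ⊤ g′ → IsDomNum G ((⊤ - x) - y) k →
                 (g′ ≤ k + 1) × (∀ D → IsGammaSet G (⊤ - x) D → y ∉ D → k + 1 ≡ g′)
    γ[G]≤γ[G-x-y]+1 x y x≢y _ _ (D′ , γD′ , refl) (T , (dT , T-minimal) , refl) = upper , equality
      where
      open ≤-Reasoning
      s≤∣T∣ : s x ≤ ∣ T ∣
      s≤∣T∣ = s-minimal-after-deletion (≢-sym x≢y) dT
      upper : ∣ D′ ∣ ≤ ∣ T ∣ + 1
      upper = begin
        ∣ D′ ∣       ≡⟨ γ-set-size γD′ ⟩
        g            ≤⟨ g≤1+s x ⟩
        suc (s x)    ≤⟨ s≤s s≤∣T∣ ⟩
        suc ∣ T ∣    ≡⟨ +-comm 1 ∣ T ∣ ⟩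
        ∣ T ∣ + 1    ∎
      equality : ∀ D → IsGammaSet G (⊤ - x) D → y ∉ D → ∣ T ∣ + 1 ≡ ∣ D′ ∣
      equality D γD y∉D = begin-equality
        ∣ T ∣ + 1    ≡⟨ +-comm ∣ T ∣ 1 ⟩
        suc ∣ T ∣    ≡⟨ cong suc (≤-antisym ∣T∣≤s s≤∣T∣) ⟩
        suc (s x)    ≡⟨ ≤-antisym (every-vertex-critical x) (g≤1+s x) ⟩
        g            ≡⟨ γ-set-size γD′ ⟨
        ∣ D′ ∣       ∎
        where
        ∣T∣≤s : ∣ T ∣ ≤ s x
        ∣T∣≤s = subst (λ D → ∣ T ∣ ≤ ∣ D ∣) (S-unique x γD) (T-minimal D (dominating-delete-∉ (proj₁ γD) y∉D))

corollary3p3 : ∀ {n} (G : Graph n) → 3 ≤ n → HypoUnique G →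
    (∀ (x u : Fin n) → u ≢ x → ∀ k m →
       IsDomNum G (⊤ - x) k → IsDomNum G ((⊤ - x) - u) m → k ≤ m)
  × (∀ (x y : Fin n) → x ≢ y → ∀ g k →
       IsDomNum G ⊤ g → IsDomNum G ((⊤ - x) - y) k →
       (g ≤ k + 1)
       × (∀ D → IsGammaSet G (⊤ - x) D → y ∉ D → k + 1 ≡ g))
corollary3p3 G 3≤n ((_ , _ , γ₁ , γ₂ , D₁≢D₂) , unique) = γ[G-x]≤γ[G-x-u] , γ[G]≤γ[G-x-y]+1
  where
  open VertexDeletion G unique γ₁
  open HypoUniqueness γ₂ D₁≢D₂ 3≤n
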